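{- For $n\ge 2$ let $f_n(t)=g_{n,\lfloor n/2\rfloor}(t)$, where $$g_{n,d}(t)=\sum_{i=1}^{\min(d,n-d)} \frac{(n-i-1)!}{(d-i)!\,(n-d-i)!\,(i-1)!}\, t^i,$$ and for $n\ge 3$ let $\mu_n=f_n'(1)/f_n(1)$. Then for all $n\ge 3$, $$\mu_n=\left(1-\frac{\lceil n/2\rceil-1}{\lceil n/2\rceil+1}\cdot\frac{f_{n-1}(1)}{f_n(1)}\right)\frac{\lceil n/2\rceil+1}{2}.$$
   Context: $g_{n,d}$ is Speyer's $g$-polynomial of the uniform matroid $U_{n,d}$; $f_n'$ is the derivative in $t$. -}

module Defs where

open import Data.Nat as ℕ using (ℕ; zero; suc; _∸_; _⊓_; _!; ⌊_/2⌋; ⌈_/2⌉)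
open import Data.Nat.Properties using (_!≢0; m*n≢0)
open import Data.Integer using (+_)
open import Data.Rational using (ℚ; 0ℚ; 1ℚ; _+_; _*_; _-_; _÷_; _≟_; _/_; ≢-nonZero)
open import Relation.Nullary using (yes; no)

Σ1 : ℕ → (ℕ → ℚ) → ℚ
Σ1 zero    h = 0ℚ
Σ1 (suc m) h = Σ1 m h + h (suc m)

_^ℚ_ : ℚ → ℕ → ℚ
q ^ℚ zero  = 1ℚ
q ^ℚ suc k = q * (q ^ℚ k)

ι : ℕ → ℚ
ι k = (+ k) / 1

coef : ℕ → ℕ → ℕ → ℚ
coef n d i =
  ((+ ((n ∸ i ∸ 1) !)) / (((d ∸ i) !) ℕ.* ((n ∸ d ∸ i) !) ℕ.* ((i ∸ 1) !)))
    {{m*n≢0 (((d ∸ i) !) ℕ.* ((n ∸ d ∸ i) !)) ((i ∸ 1) !)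
        {{m*n≢0 ((d ∸ i) !) ((n ∸ d ∸ i) !) {{(d ∸ i) !≢0}} {{(n ∸ d ∸ i) !≢0}}}}
        {{(i ∸ 1) !≢0}}}}

g : ℕ → ℕ → ℚ → ℚ
g n d t = Σ1 (d ⊓ (n ∸ d)) (λ i → coef n d i * (t ^ℚ i))

g′ : ℕ → ℕ → ℚ → ℚ
g′ n d t = Σ1 (d ⊓ (n ∸ d)) (λ i → ι i * coef n d i * (t ^ℚ (i ∸ 1)))

f : ℕ → ℚ → ℚ
f n = g n ⌊ n /2⌋

f′ : ℕ → ℚ → ℚ
f′ n = g′ n ⌊ n /2⌋

-- total division on ℚ (p ÷ 0 := 0); only used with nonzero denominators below
_⊘_ : ℚ → ℚ → ℚ
p ⊘ q with q ≟ 0ℚ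
... | yes _  = 0ℚ
... | no q≢0 = (p ÷ q) {{≢-nonZero q≢0}}

μ : ℕ → ℚ
μ n = f′ n 1ℚ ⊘ f n 1ℚ

{-# OPTIONS --safe #-}
module Submission where

-- The coefficient of t^i in g_{d+c,d} is the trinomial coefficient T(d-i, c-i, i-1), so f_n(1) and
-- f_n'(1) are sums of trinomial coefficients along a diagonal.  The claim is the recurrence
-- 2 f_n'(1) + (c-1) f_{n-1}(1) = (c+1) f_n(1), c = ⌈n/2⌉, divided by 2 f_n(1) > 0.  Keeping only the
-- terms i ≤ m, the two sides differ by the boundary term m T(d-m-1, c-m-1, m), which vanishes for the
-- complete sums; passing from m to m+1 is the three-term relation
-- (q+k+1) T(p+1,q,k) + (k+1) T(p,q,k+1) = (q+1) T(p+1,q+1,k), a consequence of the ratios between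
-- neighbouring trinomial coefficients.

module Trinomials where

  open import Data.Nat
  open import Data.Nat.Properties
  open import Data.Nat.Divisibility using (_∣_; ∣-trans; *-monoˡ-∣)
  open import Data.Nat.DivMod using (_/_; m/n*n≡m)
  open import Data.Nat.Combinatorics using (k![n∸k]!∣n!)
  open import Data.Nat.Tactic.RingSolver using (solve-∀; solve)
  open import Data.List.Base using (_∷_; [])
  open import Algebra.Properties.CommutativeSemigroup *-commutativeSemigroup using (x∙yz≈y∙xz)
  open import Relation.Binary.PropositionalEquality
  open ≡-Reasoning

  factorials : ℕ → ℕ → ℕ → ℕ
  factorials p q r = p ! * q ! * r !

  factorials≢0 : ∀ p q r → NonZero (factorials p q r)
  factorials≢0 p q r = m*n≢0 (p ! * q !) (r !) {{p !* q !≢0}} {{r !≢0}}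

  m!n!∣[m+n]! : ∀ m n → m ! * n ! ∣ (m + n) !
  m!n!∣[m+n]! m n = subst (λ k → m ! * k ! ∣ (m + n) !) (m+n∸m≡n m n) (k![n∸k]!∣n! (m≤m+n m n))

  opaque
    trinomial : ℕ → ℕ → ℕ → ℕ
    trinomial p q r = ((p + q + r) ! / factorials p q r) {{factorials≢0 p q r}}

    trinomial*factorials : ∀ p q r → trinomial p q r * factorials p q r ≡ (p + q + r) !
    trinomial*factorials p q r = m/n*n≡m {{factorials≢0 p q r}}
      (∣-trans (*-monoˡ-∣ (r !) (m!n!∣[m+n]! p q)) (m!n!∣[m+n]! (p + q) r))

  trinomial-rescale : ∀ {p q r p′ q′ r′} k l →
    l * (p + q + r) ! ≡ (p′ + q′ + r′) ! → factorials p′ q′ r′ ≡ k * factorials p q r →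
    k * trinomial p′ q′ r′ ≡ l * trinomial p q r
  trinomial-rescale {p} {q} {r} {p′} {q′} {r′} k l numerators denominators =
    *-cancelʳ-≡ _ _ F {{factorials≢0 p q r}} (begin
      k * T′ * F         ≡⟨ cong (_* F) (*-comm k T′) ⟩
      T′ * k * F         ≡⟨ *-assoc T′ k F ⟩
      T′ * (k * F)       ≡⟨ cong (T′ *_) denominators ⟨
      T′ * F′            ≡⟨ trinomial*factorials p′ q′ r′ ⟩
      (p′ + q′ + r′) !   ≡⟨ numerators ⟨
      l * (p + q + r) !  ≡⟨ cong (l *_) (trinomial*factorials p q r) ⟨
      l * (T * F)        ≡⟨ *-assoc l T F ⟨
      l * T * F          ∎)
    where
    T  = trinomial p q r
    T′ = trinomial p′ q′ r′
    F  = factorials p q r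
    F′ = factorials p′ q′ r′

  trinomial-comm : ∀ p q r → trinomial p q r ≡ trinomial q p r
  trinomial-comm p q r = begin
    trinomial p q r      ≡⟨ *-identityˡ _ ⟨
    1 * trinomial p q r  ≡⟨ trinomial-rescale {q} {p} {r} {p} {q} {r} 1 1 numerators denominators ⟩
    1 * trinomial q p r  ≡⟨ *-identityˡ _ ⟩
    trinomial q p r      ∎
    where
    numerators : 1 * (q + p + r) ! ≡ (p + q + r) !
    numerators = trans (*-identityˡ _) (cong (λ n → (n + r) !) (+-comm q p))
    denominators : factorials p q r ≡ 1 * factorials q p r
    denominators = trans (cong (_* r !) (*-comm (p !) (q !))) (sym (*-identityˡ _))

  trinomial-sucˡ : ∀ p q r → suc p * trinomial (suc p) q r ≡ suc (p + q + r) * trinomial p q r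
  trinomial-sucˡ p q r = trinomial-rescale {p} {q} {r} {suc p} {q} {r} (suc p) (suc (p + q + r))
    refl (rearrange (suc p) (p !) (q !) (r !))
    where
    rearrange : ∀ k a b c → k * a * b * c ≡ k * (a * b * c)
    rearrange = solve-∀

  trinomial-sucᵐ : ∀ p q r → suc q * trinomial p (suc q) r ≡ suc (p + q + r) * trinomial p q r
  trinomial-sucᵐ p q r = trinomial-rescale {p} {q} {r} {p} {suc q} {r} (suc q) (suc (p + q + r))
    (cong (λ n → (n + r) !) (sym (+-suc p q))) (rearrange (suc q) (p !) (q !) (r !))
    where
    rearrange : ∀ k a b c → a * (k * b) * c ≡ k * (a * b * c)
    rearrange = solve-∀

  trinomial-sucʳ : ∀ p q r → suc r * trinomial p q (suc r) ≡ suc (p + q + r) * trinomial p q r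
  trinomial-sucʳ p q r = trinomial-rescale {p} {q} {r} {p} {q} {suc r} (suc r) (suc (p + q + r))
    (cong _! (sym (+-suc (p + q) r))) (rearrange (suc r) (p !) (q !) (r !))
    where
    rearrange : ∀ k a b c → a * b * (k * c) ≡ k * (a * b * c)
    rearrange = solve-∀

  trinomial-three-term : ∀ p q k →
    (q + suc k) * trinomial (suc p) q k + suc k * trinomial p q (suc k)
      ≡ suc q * trinomial (suc p) (suc q) k
  trinomial-three-term p q k = *-cancelˡ-≡ _ _ (suc p) (begin
    suc p * ((q + suc k) * T₁₀ + suc k * T₀₁)
      ≡⟨ *-distribˡ-+ (suc p) ((q + suc k) * T₁₀) (suc k * T₀₁) ⟩
    suc p * ((q + suc k) * T₁₀) + suc p * (suc k * T₀₁)
      ≡⟨ cong (_+ suc p * (suc k * T₀₁)) (x∙yz≈y∙xz (suc p) (q + suc k) T₁₀) ⟩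
    (q + suc k) * (suc p * T₁₀) + suc p * (suc k * T₀₁)
      ≡⟨ cong₂ (λ u v → (q + suc k) * u + suc p * v) (trinomial-sucˡ p q k) (trinomial-sucʳ p q k) ⟩
    (q + suc k) * (suc N * T) + suc p * (suc N * T)
      ≡⟨ *-distribʳ-+ (suc N * T) (q + suc k) (suc p) ⟨
    (q + suc k + suc p) * (suc N * T)
      ≡⟨ cong (_* (suc N * T)) reorder ⟩
    suc (suc p + q + k) * (suc N * T)
      ≡⟨ cong (suc (suc p + q + k) *_) (trinomial-sucˡ p q k) ⟨
    suc (suc p + q + k) * (suc p * T₁₀)
      ≡⟨ x∙yz≈y∙xz (suc (suc p + q + k)) (suc p) T₁₀ ⟩
    suc p * (suc (suc p + q + k) * T₁₀)
      ≡⟨ cong (suc p *_) (trinomial-sucᵐ (suc p) q k) ⟨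
    suc p * (suc q * trinomial (suc p) (suc q) k) ∎)
    where
    N   = p + q + k
    T   = trinomial p q k
    T₁₀ = trinomial (suc p) q k
    T₀₁ = trinomial p q (suc k)
    reorder : q + suc k + suc p ≡ suc (suc p + q + k)
    reorder = solve (p ∷ q ∷ k ∷ [])

  -- trinomial (p - 1) q r, a coefficient with a negative index counting as 0
  trinomial⁻ : ℕ → ℕ → ℕ → ℕ
  trinomial⁻ zero    q r = 0
  trinomial⁻ (suc p) q r = trinomial p q r

  trinomial⁻-three-term : ∀ p q k →
    (q + suc k) * trinomial p q k + suc k * trinomial⁻ p q (suc k) ≡ suc q * trinomial p (suc q) k
  trinomial⁻-three-term (suc p) q k = trinomial-three-term p q k
  trinomial⁻-three-term zero    q k = begin
    (q + suc k) * T + suc k * 0    ≡⟨ cong ((q + suc k) * T +_) (*-zeroʳ (suc k)) ⟩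
    (q + suc k) * T + 0            ≡⟨ +-identityʳ _ ⟩
    (q + suc k) * T                ≡⟨ cong (_* T) (+-suc q k) ⟩
    suc (q + k) * T                ≡⟨ trinomial-sucᵐ 0 q k ⟨
    suc q * trinomial 0 (suc q) k  ∎
    where
    T = trinomial 0 q k

  -- diagSum w p q m = Σ_{i=1}^{m} w i · trinomial (p + m - i) (q + m - i) (i - 1); for p = 0 it is
  -- g_{2m+q,m}(1) when w = 1 and g′_{2m+q,m}(1) when w i = i.
  diagSum : (ℕ → ℕ) → ℕ → ℕ → ℕ → ℕ
  diagSum w p q zero    = 0
  diagSum w p q (suc m) = w (suc m) * trinomial p q m + diagSum w (suc p) (suc q) m

  diag diag′ : ℕ → ℕ → ℕ → ℕ
  diag  = diagSum (λ _ → 1)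
  diag′ = diagSum (λ i → i)

  diagSum-comm : ∀ w p q m → diagSum w p q m ≡ diagSum w q p m
  diagSum-comm w p q zero    = refl
  diagSum-comm w p q (suc m) =
    cong₂ (λ t s → w (suc m) * t + s) (trinomial-comm p q m) (diagSum-comm w (suc p) (suc q) m)

  diag>0 : ∀ p q m → 0 < diag p q (suc m)
  diag>0 p q m = <-≤-trans trinomial>0 (≤-trans (m≤m+n _ 0) (m≤m+n _ _))
    where
    trinomial*factorials≢0 : NonZero (trinomial p q m * factorials p q m)
    trinomial*factorials≢0 = subst NonZero (sym (trinomial*factorials p q m)) ((p + q + m) !≢0)
    trinomial>0 : 0 < trinomial p q m
    trinomial>0 = >-nonZero⁻¹ _ {{m*n≢0⇒m≢0 _ {{trinomial*factorials≢0}}}}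

  diag′-recurrence : ∀ p q m →
    2 * diag′ p (suc q) m + (q + m) * diag p q m + m * trinomial⁻ p q m ≡ (2 + q + m) * diag p (suc q) m
  diag′-recurrence p q zero    = +-identityʳ _
  diag′-recurrence p q (suc k) =
    step k q (trinomial p (suc q) k) (trinomial p q k) (trinomial⁻ p q (suc k))
      (diag′ (suc p) (suc (suc q)) k) (diag (suc p) (suc q) k) (diag (suc p) (suc (suc q)) k)
      (diag′-recurrence (suc p) (suc q) k) (trinomial⁻-three-term p q k)
    where
    step : ∀ k q t₁ t₀ t⁻ d′ d d₁ →
      2 * d′ + (suc q + k) * d + k * t₁ ≡ (2 + suc q + k) * d₁ →
      (q + suc k) * t₀ + suc k * t⁻ ≡ suc q * t₁ →
      2 * (suc k * t₁ + d′) + (q + suc k) * (1 * t₀ + d) + suc k * t⁻ ≡ (2 + q + suc k) * (1 * t₁ + d₁)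
    step k q t₁ t₀ t⁻ d′ d d₁ ih three-term = +-cancelʳ-≡ (k * t₁) _ _ (begin
      2 * (suc k * t₁ + d′) + (q + suc k) * (1 * t₀ + d) + suc k * t⁻ + k * t₁
        ≡⟨ solve (k ∷ q ∷ t₁ ∷ t₀ ∷ t⁻ ∷ d′ ∷ d ∷ []) ⟩
      (2 * d′ + (suc q + k) * d + k * t₁) + ((q + suc k) * t₀ + suc k * t⁻) + 2 * suc k * t₁
        ≡⟨ cong₂ (λ u v → u + v + 2 * suc k * t₁) ih three-term ⟩
      (2 + suc q + k) * d₁ + suc q * t₁ + 2 * suc k * t₁
        ≡⟨ solve (k ∷ q ∷ t₁ ∷ d₁ ∷ []) ⟩
      (2 + q + suc k) * (1 * t₁ + d₁) + k * t₁ ∎)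

  diag′-recurrenceˡ : ∀ q m →
    2 * diag′ 0 (suc q) m + (q + m) * diag 0 q m ≡ (2 + q + m) * diag 0 (suc q) m
  diag′-recurrenceˡ q m = begin
    L          ≡⟨ +-identityʳ L ⟨
    L + 0      ≡⟨ cong (L +_) (*-zeroʳ m) ⟨
    L + m * 0  ≡⟨ diag′-recurrence 0 q m ⟩
    (2 + q + m) * diag 0 (suc q) m ∎
    where
    L = 2 * diag′ 0 (suc q) m + (q + m) * diag 0 q m

  diag′-recurrenceʳ : ∀ p m →
    2 * diag′ p 0 (suc m) + m * diag (suc p) 0 m ≡ (2 + m) * diag p 0 (suc m)
  diag′-recurrenceʳ p m =
    split m (trinomial p 0 m) (diag′ (suc p) 1 m) (diag (suc p) 0 m) (diag (suc p) 1 m)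
      (diag′-recurrence (suc p) 0 m)
    where
    split : ∀ m t d′ d d₁ → 2 * d′ + m * d + m * t ≡ (2 + m) * d₁ →
            2 * (suc m * t + d′) + m * d ≡ (2 + m) * (1 * t + d₁)
    split m t d′ d d₁ rec = +-cancelʳ-≡ (m * t) _ _ (begin
      2 * (suc m * t + d′) + m * d + m * t    ≡⟨ solve (m ∷ t ∷ d′ ∷ d ∷ []) ⟩
      2 * d′ + m * d + m * t + 2 * suc m * t  ≡⟨ cong (_+ 2 * suc m * t) rec ⟩
      (2 + m) * d₁ + 2 * suc m * t            ≡⟨ solve (m ∷ t ∷ d₁ ∷ []) ⟩
      (2 + m) * (1 * t + d₁) + m * t          ∎)

open import Defs
open import Data.Nat.Base as ℕ
  using (ℕ; zero; suc; _∸_; _≤_; _<_; _⊓_; z≤n; s≤s; z<s; ⌊_/2⌋; ⌈_/2⌉)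
import Data.Nat.Properties as ℕ
open import Data.Integer.Base using (+_)
import Data.Integer.Base as ℤ
import Data.Integer.Properties as ℤ
import Data.Integer.Tactic.RingSolver as ℤ
open import Data.Rational.Base using (ℚ; 0ℚ; 1ℚ; _+_; _*_; _-_; _/_; 1/_; toℚᵘ; ≢-nonZero)
open import Data.Rational.Properties
  using (_≟_; toℚᵘ-injective; toℚᵘ-fromℚᵘ; fromℚᵘ-cong; toℚᵘ-homo-+; toℚᵘ-homo-*;
         normalize-pos; positive⁻¹; <-irrefl; /-cong;
         *-assoc; *-identityˡ; *-identityʳ; *-inverseˡ; *-inverseʳ)
import Data.Rational.Unnormalised.Base as ℚᵘ
import Data.Rational.Unnormalised.Properties as ℚᵘ
open import Data.Rational.Solver using (module +-*-Solver)
open import Relation.Binary.PropositionalEquality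
open import Relation.Nullary using (yes; no; contradiction)

open Trinomials

toℚᵘ-ι : ∀ n → toℚᵘ (ι n) ℚᵘ.≃ ℚᵘ.mkℚᵘ (+ n) 0
toℚᵘ-ι n = toℚᵘ-fromℚᵘ (ℚᵘ.mkℚᵘ (+ n) 0)

ι-homo-+ : ∀ m n → ι (m ℕ.+ n) ≡ ι m + ι n
ι-homo-+ m n = toℚᵘ-injective (begin
  toℚᵘ (ι (m ℕ.+ n))                    ≈⟨ toℚᵘ-ι (m ℕ.+ n) ⟩
  ℚᵘ.mkℚᵘ (+ (m ℕ.+ n)) 0
    ≈⟨ ℚᵘ.*≡* (trans (cong (ℤ._* ℤ.1ℤ) (ℤ.pos-+ m n)) (distrib (+ m) (+ n))) ⟩
  ℚᵘ.mkℚᵘ (+ m) 0 ℚᵘ.+ ℚᵘ.mkℚᵘ (+ n) 0  ≈⟨ ℚᵘ.+-cong (toℚᵘ-ι m) (toℚᵘ-ι n) ⟨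
  toℚᵘ (ι m) ℚᵘ.+ toℚᵘ (ι n)            ≈⟨ toℚᵘ-homo-+ (ι m) (ι n) ⟨
  toℚᵘ (ι m + ι n)                      ∎)
  where
  open ℚᵘ.≃-Reasoning
  distrib : ∀ x y → (x ℤ.+ y) ℤ.* ℤ.1ℤ ≡ (x ℤ.* ℤ.1ℤ ℤ.+ y ℤ.* ℤ.1ℤ) ℤ.* ℤ.1ℤ
  distrib = ℤ.solve-∀

ι-homo-* : ∀ m n → ι (m ℕ.* n) ≡ ι m * ι n
ι-homo-* m n = toℚᵘ-injective (begin
  toℚᵘ (ι (m ℕ.* n))                    ≈⟨ toℚᵘ-ι (m ℕ.* n) ⟩
  ℚᵘ.mkℚᵘ (+ (m ℕ.* n)) 0               ≈⟨ ℚᵘ.*≡* (cong (ℤ._* ℤ.1ℤ) (ℤ.pos-* m n)) ⟩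
  ℚᵘ.mkℚᵘ (+ m) 0 ℚᵘ.* ℚᵘ.mkℚᵘ (+ n) 0  ≈⟨ ℚᵘ.*-cong (toℚᵘ-ι m) (toℚᵘ-ι n) ⟨
  toℚᵘ (ι m) ℚᵘ.* toℚᵘ (ι n)            ≈⟨ toℚᵘ-homo-* (ι m) (ι n) ⟨
  toℚᵘ (ι m * ι n)                      ∎)
  where open ℚᵘ.≃-Reasoning

ι≢0 : ∀ {n} → 0 < n → ι n ≢ 0ℚ
ι≢0 {suc n} _ ι≡0 = <-irrefl (sym ι≡0) (positive⁻¹ (ι (suc n)) {{normalize-pos (suc n) 1}})

t*b/b≡t : ∀ t b .{{_ : ℕ.NonZero b}} → (+ (t ℕ.* b)) / b ≡ ι t
t*b/b≡t t (suc b) = fromℚᵘ-cong t*b/b≃t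
  where
  t*b/b≃t : ℚᵘ.mkℚᵘ (+ (t ℕ.* suc b)) b ℚᵘ.≃ ℚᵘ.mkℚᵘ (+ t) 0
  t*b/b≃t = ℚᵘ.*≡* (trans (ℤ.*-identityʳ (+ (t ℕ.* suc b))) (ℤ.pos-* t (suc b)))

⊘-*-cancel : ∀ x {y} → y ≢ 0ℚ → (x ⊘ y) * y ≡ x
⊘-*-cancel x {y} y≢0 with y ≟ 0ℚ
... | yes y≡0 = contradiction y≡0 y≢0
... | no _    = begin
  x * 1/ y * y    ≡⟨ *-assoc x (1/ y) y ⟩
  x * (1/ y * y)  ≡⟨ cong (x *_) (*-inverseˡ y) ⟩
  x * 1ℚ          ≡⟨ *-identityʳ x ⟩
  x               ∎
  where
  open ≡-Reasoning
  instance _ = ≢-nonZero y≢0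

*-⊘-cancel : ∀ z {y} → y ≢ 0ℚ → (z * y) ⊘ y ≡ z
*-⊘-cancel z {y} y≢0 with y ≟ 0ℚ
... | yes y≡0 = contradiction y≡0 y≢0
... | no _    = begin
  z * y * 1/ y    ≡⟨ *-assoc z y (1/ y) ⟩
  z * (y * 1/ y)  ≡⟨ cong (z *_) (*-inverseʳ y) ⟩
  z * 1ℚ          ≡⟨ *-identityʳ z ⟩
  z               ∎
  where
  open ≡-Reasoning
  instance _ = ≢-nonZero y≢0

⊘-from-linear : ∀ {x y z a b} → y ≢ 0ℚ → b ≢ 0ℚ → ι 2 * x + a * z ≡ b * y →
                x ⊘ y ≡ (1ℚ - (a ⊘ b) * (z ⊘ y)) * (b ⊘ ι 2)
⊘-from-linear {x} {y} {z} {a} {b} y≢0 b≢0 linear = subst (λ x → x ⊘ y ≡ w) w*y≡x (*-⊘-cancel w y≢0)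
  where
  open ≡-Reasoning
  open +-*-Solver
  ½ = 1/ ι 2
  w = (1ℚ - (a ⊘ b) * (z ⊘ y)) * (b ⊘ ι 2)
  -- b ⊘ ι 2 reduces to b * ½, since ι 2 ≟ 0ℚ evaluates to no
  w*y≡x : w * y ≡ x
  w*y≡x = begin
    (1ℚ - (a ⊘ b) * (z ⊘ y)) * (b * ½) * y
      ≡⟨ solve 5 (λ A Z b y h → (con 1ℚ :- A :* Z) :* (b :* h) :* y
                                 := (b :* y :- (A :* b) :* (Z :* y)) :* h)
               refl (a ⊘ b) (z ⊘ y) b y ½ ⟩
    (b * y - ((a ⊘ b) * b) * ((z ⊘ y) * y)) * ½
      ≡⟨ cong₂ (λ u v → (b * y - u * v) * ½) (⊘-*-cancel a b≢0) (⊘-*-cancel z y≢0) ⟩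
    (b * y - a * z) * ½
      ≡⟨ cong (λ u → (u - a * z) * ½) linear ⟨
    (ι 2 * x + a * z - a * z) * ½
      ≡⟨ solve 3 (λ x a z → (con (ι 2) :* x :+ a :* z :- a :* z) :* con ½ := x) refl x a z ⟩
    x ∎

coef-trinomial : ∀ d c i → 1 ≤ i → i ≤ d → d ≤ c →
                 coef (d ℕ.+ c) d i ≡ ι (trinomial (d ∸ i) (c ∸ i) (i ∸ 1))
coef-trinomial d c i 1≤i i≤d d≤c = begin
  coef (d ℕ.+ c) d i
    ≡⟨ /-cong {{factorials≢0 (d ∸ i) (d ℕ.+ c ∸ d ∸ i) (i ∸ 1)}}
              (cong +_ (trans (cong ℕ._! index) (sym (trinomial*factorials (d ∸ i) (c ∸ i) (i ∸ 1)))))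
              (cong (λ c′ → factorials (d ∸ i) (c′ ∸ i) (i ∸ 1)) (ℕ.m+n∸m≡n d c)) ⟩
  (+ (T ℕ.* F)) / F
    ≡⟨ t*b/b≡t T F ⟩
  ι T ∎
  where
  open ≡-Reasoning
  T = trinomial (d ∸ i) (c ∸ i) (i ∸ 1)
  F = factorials (d ∸ i) (c ∸ i) (i ∸ 1)
  instance
    F≢0 : ℕ.NonZero F
    F≢0 = factorials≢0 (d ∸ i) (c ∸ i) (i ∸ 1)
  i≤c = ℕ.≤-trans i≤d d≤c
  index : d ℕ.+ c ∸ i ∸ 1 ≡ (d ∸ i) ℕ.+ (c ∸ i) ℕ.+ (i ∸ 1)
  index = begin
    d ℕ.+ c ∸ i ∸ 1                    ≡⟨ cong (_∸ 1) (ℕ.+-∸-comm c i≤d) ⟩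
    (d ∸ i) ℕ.+ c ∸ 1                  ≡⟨ ℕ.+-∸-assoc (d ∸ i) (ℕ.≤-trans 1≤i i≤c) ⟩
    (d ∸ i) ℕ.+ (c ∸ 1)                ≡⟨ cong (λ c′ → (d ∸ i) ℕ.+ (c′ ∸ 1)) (ℕ.m∸n+n≡m i≤c) ⟨
    (d ∸ i) ℕ.+ ((c ∸ i) ℕ.+ i ∸ 1)    ≡⟨ cong ((d ∸ i) ℕ.+_) (ℕ.+-∸-assoc (c ∸ i) 1≤i) ⟩
    (d ∸ i) ℕ.+ ((c ∸ i) ℕ.+ (i ∸ 1))  ≡⟨ ℕ.+-assoc (d ∸ i) (c ∸ i) (i ∸ 1) ⟨
    (d ∸ i) ℕ.+ (c ∸ i) ℕ.+ (i ∸ 1)    ∎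

Σ1-cong : ∀ m {h h′ : ℕ → ℚ} → (∀ i → 1 ≤ i → i ≤ m → h i ≡ h′ i) → Σ1 m h ≡ Σ1 m h′
Σ1-cong zero    eq = refl
Σ1-cong (suc m) eq = cong₂ _+_
  (Σ1-cong m (λ i 1≤i i≤m → eq i 1≤i (ℕ.m≤n⇒m≤1+n i≤m))) (eq (suc m) (s≤s z≤n) ℕ.≤-refl)

Σ1-diagSum : ∀ w p q m →
  Σ1 m (λ i → ι (w i ℕ.* trinomial (p ℕ.+ m ∸ i) (q ℕ.+ m ∸ i) (i ∸ 1))) ≡ ι (diagSum w p q m)
Σ1-diagSum w p q zero    = refl
Σ1-diagSum w p q (suc m) = begin
  Σ1 m (term (p ℕ.+ suc m) (q ℕ.+ suc m))
    + ι (w (suc m) ℕ.* trinomial (p ℕ.+ suc m ∸ suc m) (q ℕ.+ suc m ∸ suc m) m)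
    ≡⟨ cong₂ _+_ (cong₂ (λ a b → Σ1 m (term a b)) (ℕ.+-suc p m) (ℕ.+-suc q m))
                 (cong₂ (λ a b → ι (w (suc m) ℕ.* trinomial a b m))
                        (ℕ.m+n∸n≡m p (suc m)) (ℕ.m+n∸n≡m q (suc m))) ⟩
  Σ1 m (term (suc p ℕ.+ m) (suc q ℕ.+ m)) + ι top
    ≡⟨ cong (_+ ι top) (Σ1-diagSum w (suc p) (suc q) m) ⟩
  ι (diagSum w (suc p) (suc q) m) + ι top
    ≡⟨ ι-homo-+ (diagSum w (suc p) (suc q) m) top ⟨
  ι (diagSum w (suc p) (suc q) m ℕ.+ top)
    ≡⟨ cong ι (ℕ.+-comm (diagSum w (suc p) (suc q) m) top) ⟩
  ι (diagSum w p q (suc m)) ∎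
  where
  open ≡-Reasoning
  top = w (suc m) ℕ.* trinomial p q m
  term : ℕ → ℕ → ℕ → ℚ
  term a b i = ι (w i ℕ.* trinomial (a ∸ i) (b ∸ i) (i ∸ 1))

Σ1-min-diagSum : ∀ w q m {h : ℕ → ℚ} →
  (∀ i → 1 ≤ i → i ≤ m → h i ≡ ι (w i ℕ.* trinomial (m ∸ i) (q ℕ.+ m ∸ i) (i ∸ 1))) →
  Σ1 (m ⊓ (m ℕ.+ (q ℕ.+ m) ∸ m)) h ≡ ι (diagSum w 0 q m)
Σ1-min-diagSum w q m {h} eq = begin
  Σ1 (m ⊓ (m ℕ.+ (q ℕ.+ m) ∸ m)) h
    ≡⟨ cong (λ K → Σ1 K h) (trans (cong (m ⊓_) (ℕ.m+n∸m≡n m (q ℕ.+ m)))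
                                  (ℕ.m≤n⇒m⊓n≡m (ℕ.m≤n+m m q))) ⟩
  Σ1 m h
    ≡⟨ Σ1-cong m eq ⟩
  Σ1 m (λ i → ι (w i ℕ.* trinomial (m ∸ i) (q ℕ.+ m ∸ i) (i ∸ 1)))
    ≡⟨ Σ1-diagSum w 0 q m ⟩
  ι (diagSum w 0 q m) ∎
  where open ≡-Reasoning

1ℚ^k≡1ℚ : ∀ k → 1ℚ ^ℚ k ≡ 1ℚ
1ℚ^k≡1ℚ zero    = refl
1ℚ^k≡1ℚ (suc k) = trans (*-identityˡ (1ℚ ^ℚ k)) (1ℚ^k≡1ℚ k)

g-at-one : ∀ q m → g (m ℕ.+ (q ℕ.+ m)) m 1ℚ ≡ ι (diag 0 q m)
g-at-one q m = Σ1-min-diagSum (λ _ → 1) q m λ i 1≤i i≤m → begin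
  coef n m i * (1ℚ ^ℚ i)  ≡⟨ cong (coef n m i *_) (1ℚ^k≡1ℚ i) ⟩
  coef n m i * 1ℚ         ≡⟨ *-identityʳ (coef n m i) ⟩
  coef n m i              ≡⟨ coef-trinomial m (q ℕ.+ m) i 1≤i i≤m (ℕ.m≤n+m m q) ⟩
  ι (T i)                 ≡⟨ cong ι (ℕ.*-identityˡ (T i)) ⟨
  ι (1 ℕ.* T i)           ∎
  where
  open ≡-Reasoning
  n = m ℕ.+ (q ℕ.+ m)
  T : ℕ → ℕ
  T i = trinomial (m ∸ i) (q ℕ.+ m ∸ i) (i ∸ 1)

g′-at-one : ∀ q m → g′ (m ℕ.+ (q ℕ.+ m)) m 1ℚ ≡ ι (diag′ 0 q m)
g′-at-one q m = Σ1-min-diagSum (λ i → i) q m λ i 1≤i i≤m → begin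
  ι i * coef n m i * (1ℚ ^ℚ (i ∸ 1))  ≡⟨ cong (ι i * coef n m i *_) (1ℚ^k≡1ℚ (i ∸ 1)) ⟩
  ι i * coef n m i * 1ℚ               ≡⟨ *-identityʳ (ι i * coef n m i) ⟩
  ι i * coef n m i                    ≡⟨ cong (ι i *_) (coef-trinomial m (q ℕ.+ m) i 1≤i i≤m (ℕ.m≤n+m m q)) ⟩
  ι i * ι (T i)                       ≡⟨ ι-homo-* i (T i) ⟨
  ι (i ℕ.* T i)                       ∎
  where
  open ≡-Reasoning
  n = m ℕ.+ (q ℕ.+ m)
  T : ℕ → ℕ
  T i = trinomial (m ∸ i) (q ℕ.+ m ∸ i) (i ∸ 1)

⌊q+m+m/2⌋≡m : ∀ {q} m → q ≤ 1 → ⌊ q ℕ.+ m ℕ.+ m /2⌋ ≡ m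
⌊q+m+m/2⌋≡m m z≤n       = sym (ℕ.n≡⌊n+n/2⌋ m)
⌊q+m+m/2⌋≡m m (s≤s z≤n) = sym (ℕ.n≡⌈n+n/2⌉ m)

f-at-one : ∀ {q} m → q ≤ 1 → f (q ℕ.+ m ℕ.+ m) 1ℚ ≡ ι (diag 0 q m)
f-at-one {q} m q≤1 =
  trans (cong₂ (λ n d → g n d 1ℚ) (ℕ.+-comm (q ℕ.+ m) m) (⌊q+m+m/2⌋≡m m q≤1)) (g-at-one q m)

f′-at-one : ∀ {q} m → q ≤ 1 → f′ (q ℕ.+ m ℕ.+ m) 1ℚ ≡ ι (diag′ 0 q m)
f′-at-one {q} m q≤1 =
  trans (cong₂ (λ n d → g′ n d 1ℚ) (ℕ.+-comm (q ℕ.+ m) m) (⌊q+m+m/2⌋≡m m q≤1)) (g′-at-one q m)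

data Halving : ℕ → Set where
  even : ∀ m → Halving (m ℕ.+ m)
  odd  : ∀ m → Halving (suc (m ℕ.+ m))

halving : ∀ n → Halving n
halving zero = even zero
halving (suc n) with halving n
... | even m = odd m
... | odd m  = subst Halving (cong suc (ℕ.+-suc m m)) (even (suc m))

f′-recurrence-from : ∀ n {a x y z} → ⌈ n /2⌉ ≡ suc a →
  f′ n 1ℚ ≡ ι x → f (n ∸ 1) 1ℚ ≡ ι z → f n 1ℚ ≡ ι y →
  2 ℕ.* x ℕ.+ a ℕ.* z ≡ (2 ℕ.+ a) ℕ.* y →
  ι 2 * f′ n 1ℚ + ι (⌈ n /2⌉ ∸ 1) * f (n ∸ 1) 1ℚ ≡ ι (suc ⌈ n /2⌉) * f n 1ℚ
f′-recurrence-from n {a} {x} {y} {z} ⌈n/2⌉≡1+a f′≡x f≡z f≡y identity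
  rewrite ⌈n/2⌉≡1+a | f′≡x | f≡z | f≡y = begin
  ι 2 * ι x + ι a * ι z      ≡⟨ cong₂ _+_ (ι-homo-* 2 x) (ι-homo-* a z) ⟨
  ι (2 ℕ.* x) + ι (a ℕ.* z)  ≡⟨ ι-homo-+ (2 ℕ.* x) (a ℕ.* z) ⟨
  ι (2 ℕ.* x ℕ.+ a ℕ.* z)    ≡⟨ cong ι identity ⟩
  ι ((2 ℕ.+ a) ℕ.* y)        ≡⟨ ι-homo-* (2 ℕ.+ a) y ⟩
  ι (2 ℕ.+ a) * ι y          ∎
  where open ≡-Reasoning

f′-recurrence : ∀ n →
  ι 2 * f′ n 1ℚ + ι (⌈ n /2⌉ ∸ 1) * f (n ∸ 1) 1ℚ ≡ ι (suc ⌈ n /2⌉) * f n 1ℚ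
f′-recurrence n with halving n
... | even zero    = refl
... | even (suc k) =
  f′-recurrence-from (suc k ℕ.+ suc k) {k} {diag′ 0 0 (suc k)} {diag 0 0 (suc k)} {diag 0 1 k}
    (sym (ℕ.n≡⌈n+n/2⌉ (suc k))) (f′-at-one (suc k) z≤n) f-previous (f-at-one (suc k) z≤n) identity
  where
  f-previous : f (k ℕ.+ suc k) 1ℚ ≡ ι (diag 0 1 k)
  f-previous = trans (cong (λ n → f n 1ℚ) (ℕ.+-suc k k)) (f-at-one k (s≤s z≤n))
  identity : 2 ℕ.* diag′ 0 0 (suc k) ℕ.+ k ℕ.* diag 0 1 k ≡ (2 ℕ.+ k) ℕ.* diag 0 0 (suc k)
  identity = subst (λ d → 2 ℕ.* diag′ 0 0 (suc k) ℕ.+ k ℕ.* d ≡ (2 ℕ.+ k) ℕ.* diag 0 0 (suc k))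
                   (diagSum-comm (λ _ → 1) 1 0 k) (diag′-recurrenceʳ 0 k)
... | odd m =
  f′-recurrence-from (suc (m ℕ.+ m)) {m} {diag′ 0 1 m} {diag 0 1 m} {diag 0 0 m}
    (cong suc (sym (ℕ.n≡⌊n+n/2⌋ m)))
    (f′-at-one m (s≤s z≤n)) (f-at-one m z≤n) (f-at-one m (s≤s z≤n)) (diag′-recurrenceˡ 0 m)

f-at-one≢0 : ∀ n → 2 ≤ n → f n 1ℚ ≢ 0ℚ
f-at-one≢0 n 2≤n with halving n
f-at-one≢0 _ ()       | even zero
f-at-one≢0 _ (s≤s ()) | odd zero
f-at-one≢0 _ _        | even (suc k) =
  subst (_≢ 0ℚ) (sym (f-at-one (suc k) z≤n)) (ι≢0 (diag>0 0 0 k))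
f-at-one≢0 _ _        | odd (suc k)  =
  subst (_≢ 0ℚ) (sym (f-at-one (suc k) (s≤s z≤n))) (ι≢0 (diag>0 0 1 k))

lemma4p4 : (n : ℕ) → 3 ≤ n →
    μ n ≡ (1ℚ - ((ι (⌈ n /2⌉ ∸ 1) ⊘ ι (suc ⌈ n /2⌉)) * (f (n ∸ 1) 1ℚ ⊘ f n 1ℚ)))
    * (ι (suc ⌈ n /2⌉) ⊘ ι 2)
lemma4p4 n 3≤n =
  ⊘-from-linear {f′ n 1ℚ} {f n 1ℚ} {f (n ∸ 1) 1ℚ} {ι (⌈ n /2⌉ ∸ 1)} {ι (suc ⌈ n /2⌉)}
    (f-at-one≢0 n (ℕ.<⇒≤ 3≤n)) (ι≢0 {suc ⌈ n /2⌉} z<s) (f′-recurrence n)
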